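{- Let $n,m\ge1$, $\ell:[m]\to[n]$ a map, $\mathbb{d}_H=|\ell([m])|$ and $\mathbb{d}_P=m-\mathbb{d}_H$. A word $S\in\{H,P\}^{n+m-2}$ containing exactly $n-1$ letters $H$ and $m-1$ letters $P$ is admissible for type $(n,m,\ell)$ if and only if for every $i\in\{1,\dots,n+m-2\}$, $$|\{j\le i: S_j=P\}|\le |\{j\le i: S_j=H\}|+\mathbb{d}_P.$$
   Context: An ultrametric phylogenetic tree on a finite leaf set $L$ is a rooted tree with leaves bijectively labelled by $L$, no non-root degree-2 vertices, nonnegative edge lengths and all leaves equidistant from the root; leaves sit at time $0$ and each internal vertex has time equal to its distance to its descendant leaves; $d_T(i,j)$ is leaf-to-leaf path length. A nested tree of type $(n,m,\ell)$ is a pair $(T_H,T_P)$ of such trees on $[n]=\{1,\dots,n\}$ (host) and $[m]$ (parasite) with $d^P(i,j)\ge d^H(\ell(i),\ell(j))$ for all $i,j\in[m]$. It is fully resolved if both trees are binary and the $n+m-2$ internal vertices of the two trees have pairwise distinct times; listing these vertices in increasing order of time, its nesting sequence $S\in\{H,P\}^{n+m-2}$ has $S_i=H$ if the $i$-th vertex is in $T_H$ and $S_i=P$ if it is in $T_P$. A word $S$ is admissible for type $(n,m,\ell)$ if it is the nesting sequence of some fully resolved nested tree of type $(n,m,\ell)$.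
   Formalization: The vertex times and edge lengths of the host and parasite trees in the definition of admissibility are rational. -}

module Defs where

open import Data.Nat using (ℕ; zero; suc; _∸_)
open import Data.Bool using (Bool; true; false; _∧_; _∨_; if_then_else_)
open import Data.Fin using (Fin; toℕ)
open import Data.Fin.Properties using (any?)
open import Data.Fin.Properties using () renaming (_≟_ to _≟ᶠ_)
open import Data.List using (List; []; _∷_; _++_; length; filter; map)
open import Data.List.Base using (allFin)
open import Data.Vec using (Vec)
open import Data.Product using (Σ; _×_; _,_; proj₁; proj₂; ∃)
open import Data.Rational using (ℚ; 0ℚ; _+_; _≤_; _<_)
open import Data.List.Relation.Binary.Permutation.Propositional using (_↭_)
open import Data.List.Relation.Unary.Unique.Propositional using (Unique)
open import Data.List.Relation.Unary.Linked using (Linked)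
open import Relation.Nullary using (does)
open import Relation.Binary.PropositionalEquality using (_≡_)

data Letter : Set where
  H P : Letter

-- Binary rooted trees with leaves labelled in Fin k; each internal
-- vertex carries its time (distance to its descendant leaves).
-- Leaves are at time 0.  Edge lengths are the time differences.
data BTree (k : ℕ) : Set where
  leaf : Fin k → BTree k
  node : ℚ → BTree k → BTree k → BTree k

leaves : ∀ {k} → BTree k → List (Fin k)
leaves (leaf a) = a ∷ []
leaves (node _ l r) = leaves l ++ leaves r

rootTime : ∀ {k} → BTree k → ℚ
rootTime (leaf _) = 0ℚ
rootTime (node q _ _) = q

internalTimes : ∀ {k} → BTree k → List ℚ
internalTimes (leaf _) = []
internalTimes (node q l r) = q ∷ (internalTimes l ++ internalTimes r)

-- nonnegative edge lengths: parent time ≥ child time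
MonotoneTimes : ∀ {k} → BTree k → Set
MonotoneTimes (leaf _) = Data.Unit.⊤
  where import Data.Unit
MonotoneTimes (node q l r) =
  (rootTime l ≤ q) × (rootTime r ≤ q) × MonotoneTimes l × MonotoneTimes r

UltraBinTree : (k : ℕ) → BTree k → Set
UltraBinTree k t = (leaves t ↭ allFin k) × MonotoneTimes t

elemB : ∀ {k} → Fin k → List (Fin k) → Bool
elemB i [] = false
elemB i (x ∷ xs) = does (x ≟ᶠ i) ∨ elemB i xs

lcaTime : ∀ {k} → BTree k → Fin k → Fin k → ℚ
lcaTime (leaf _) i j = 0ℚ
lcaTime (node q l r) i j =
  if elemB i (leaves l) ∧ elemB j (leaves l) then lcaTime l i j
  else if elemB i (leaves r) ∧ elemB j (leaves r) then lcaTime r i j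
  else q

-- leaf-to-leaf path length in an ultrametric tree (= 2 * MRCA time)
dist : ∀ {k} → BTree k → Fin k → Fin k → ℚ
dist t i j = lcaTime t i j + lcaTime t i j

Nests : ∀ {n m} → (Fin m → Fin n) → BTree n → BTree m → Set
Nests ℓ tH tP = ∀ i j → dist tH (ℓ i) (ℓ j) ≤ dist tP i j

-- all internal vertex times pairwise distinct (binarity is built in)
FullyResolved : ∀ {n m} → BTree n → BTree m → Set
FullyResolved tH tP = Unique (internalTimes tH ++ internalTimes tP)

timesOf : Letter → List (Letter × ℚ) → List ℚ
timesOf _ [] = []
timesOf H ((H , q) ∷ xs) = q ∷ timesOf H xs
timesOf H ((P , q) ∷ xs) = timesOf H xs
timesOf P ((H , q) ∷ xs) = timesOf P xs
timesOf P ((P , q) ∷ xs) = q ∷ timesOf P xs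

-- S lists the internal vertices of both trees, in increasing order
-- of time, recording which tree each comes from
IsNestingSequence : ∀ {n m} → List Letter → BTree n → BTree m → Set
IsNestingSequence S tH tP =
  Σ (List (Letter × ℚ)) λ xs →
    (map proj₁ xs ≡ S)
    × Linked (λ a b → proj₂ a < proj₂ b) xs
    × (timesOf H xs ↭ internalTimes tH)
    × (timesOf P xs ↭ internalTimes tP)

Admissible : (n m : ℕ) → (Fin m → Fin n) → List Letter → Set
Admissible n m ℓ S =
  Σ (BTree n) λ tH → Σ (BTree m) λ tP →
    UltraBinTree n tH × UltraBinTree m tP × Nests ℓ tH tP
    × FullyResolved tH tP × IsNestingSequence S tH tP

count : Letter → List Letter → ℕ
count H [] = 0
count H (H ∷ xs) = suc (count H xs)
count H (P ∷ xs) = count H xs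
count P [] = 0
count P (H ∷ xs) = count P xs
count P (P ∷ xs) = suc (count P xs)

imageSize : ∀ {n m} → (Fin m → Fin n) → ℕ
imageSize {n} ℓ = length (filter (λ y → any? (λ x → ℓ x ≟ᶠ y)) (allFin n))

-- Necessity. Cut both trees at a time τ: the clusters of a tree are its maximal subtrees with
-- root time ≤ τ, and a tree with k leaves and h internal vertices of time ≤ τ has k − h clusters.
-- By nesting, the leaves of a parasite cluster are mapped into a single host cluster, so at most
-- m − p host clusters meet the image of ℓ, where p counts the parasite vertices of time ≤ τ. A host
-- cluster holds at most one more image point than it has internal vertices, so 𝕕_H ≤ (m − p) + h,
-- i.e. p ≤ h + 𝕕_P. Taking τ to be the time of the i-th vertex of the nesting sequence gives the
-- prefix inequality.
--
-- Sufficiency. Give the i-th letter time i. The host tree is a caterpillar with leaves the image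
-- points x₁, …, x_k followed by the remaining host leaves. The parasite tree first builds a
-- caterpillar over each fiber ℓ⁻¹(x) from the 𝕕_P earliest P-times, then joins these fiber trees
-- in the order x₁, …, x_k using the remaining k − 1 P-times. The prefix inequality implies
-- that the (𝕕_P + i)-th P-time is later than the i-th H-time, at which x_{i+1} joins the host
-- caterpillar; so every parasite subtree is hosted by a host subtree that is not older, and this
-- gives the nesting inequality.

module Submission where

open import Defs
open import Data.Bool using (true; false; _∧_)
open import Data.Nat using (ℕ; zero; suc; _+_; _∸_; _≤_; _<_; z≤n; s≤s)
import Data.Nat.Properties as ℕ
open import Data.Fin using (Fin; toℕ; fromℕ<; zero; suc)
open import Data.Fin.Properties using (toℕ<n; any?) renaming (_≟_ to _≟ᶠ_)
open import Data.Vec using (Vec; toList; []; _∷_)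
open import Data.Vec.Properties using (length-toList)
open import Data.List using (List; []; _∷_; _++_; length; map; concat; take; drop; filter; allFin)
open import Data.Nat.ListAction using (sum)
open import Data.List.Properties
  using (length-++; length-map; length-drop; length-tabulate; filter-++; filter-accept; filter-reject;
         filter-none; filter-all; length-filter; partition-defn; take-[]; ++-identityʳ; ++-assoc;
         map-++; concat-++; take-all; take++drop≡id; drop-[])
open import Data.List.Membership.Propositional using (_∈_; _∉_; lose; find)
open import Data.List.Membership.Propositional.Properties
  using (∈-++⁺ˡ; ∈-++⁺ʳ; ∈-++⁻; ∈-allFin; ∈-filter⁺; ∈-filter⁻; ∈-concat⁺′; ∈-map⁺; ∈-map⁻;
         ∈-length)
open import Data.List.Relation.Unary.Any as Any using (Any; here; there)
open import Data.List.Relation.Unary.All as All using (All; []; _∷_)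
import Data.List.Relation.Unary.All.Properties as All
import Data.List.Relation.Unary.Any.Properties as Any
import Data.List.Relation.Unary.AllPairs as AllPairs
import Data.List.Relation.Unary.AllPairs.Properties as AllPairs
open import Data.List.Relation.Unary.AllPairs using (AllPairs; []; _∷_)
open import Data.List.Relation.Unary.Linked using (Linked)
import Data.List.Relation.Unary.Linked.Properties as Linkedₚ
open import Data.List.Relation.Unary.Unique.Propositional using (Unique)
import Data.List.Relation.Unary.Unique.Propositional.Properties as Uniqueₚ
open Uniqueₚ using (allFin⁺)
open import Data.List.Membership.Propositional.Properties.WithK using (unique∧set⇒bag)
open import Data.List.Relation.Binary.BagAndSetEquality using (∼bag⇒↭)
open import Data.List.Relation.Binary.Disjoint.Propositional using (Disjoint)
open import Data.List.Relation.Binary.Permutation.Propositional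
  using (_↭_; prep; ↭-refl; ↭-reflexive; ↭-sym; ↭-trans; ↭⇒↭ₛ; ↭ₛ⇒↭; module PermutationReasoning)
open import Data.List.Relation.Binary.Permutation.Propositional.Properties
  using (↭-length; ∈-resp-↭; filter-↭; shift; ++⁺ˡ; ++⁺; ++-comm)
import Data.List.Relation.Binary.Permutation.Setoid.Properties as Permutationₛ
open import Data.Product using (∃-syntax; _×_; _,_; proj₁; proj₂; uncurry)
open import Data.Sum using (_⊎_; inj₁; inj₂)
open import Data.Empty using (⊥; ⊥-elim)
open import Data.Rational as ℚ using (ℚ; 0ℚ; 1ℚ)
import Data.Rational.Properties as ℚₚ
open import Relation.Binary.PropositionalEquality
  using (_≡_; _≢_; refl; sym; trans; cong; cong₂; subst; subst₂; setoid; module ≡-Reasoning)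
open import Relation.Nullary using (¬_; Dec; yes; no)
open import Relation.Nullary.Decidable using (_⊎-dec_)
open import Relation.Unary using (Decidable)
open import Relation.Unary.Properties using (∁?)
open import Function using (_∘_)
open import Algebra.Properties.CommutativeSemigroup ℕ.+-commutativeSemigroup using (interchange; x∙yz≈y∙xz)
open import Function.Bundles using (_⇔_; mk⇔)

module _ {A : Set} where

  Unique-resp-↭ : ∀ {xs ys : List A} → xs ↭ ys → Unique xs → Unique ys
  Unique-resp-↭ xs↭ys = Permutationₛ.Unique-resp-↭ (setoid A) (↭⇒↭ₛ xs↭ys)

  Unique-++⁻ˡ : ∀ (xs : List A) {ys} → Unique (xs ++ ys) → Unique xs
  Unique-++⁻ˡ []       _          = []
  Unique-++⁻ˡ (x ∷ xs) (x∉ ∷ xs!) = All.++⁻ˡ xs x∉ ∷ Unique-++⁻ˡ xs xs!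

  Unique-++⁻ʳ : ∀ (xs : List A) {ys} → Unique (xs ++ ys) → Unique ys
  Unique-++⁻ʳ []       ys!        = ys!
  Unique-++⁻ʳ (x ∷ xs) (_ ∷ xsys!) = Unique-++⁻ʳ xs xsys!

  Unique-++-disjoint : ∀ (xs : List A) {ys x} → Unique (xs ++ ys) → x ∈ xs → x ∈ ys → ⊥
  Unique-++-disjoint (x ∷ xs) (x∉ ∷ _)     (here refl) x∈ys = All.lookup (All.++⁻ʳ xs x∉) x∈ys refl
  Unique-++-disjoint (_ ∷ xs) (_ ∷ xsys!) (there x∈xs) x∈ys = Unique-++-disjoint xs xsys! x∈xs x∈ys

  module _ {P : A → Set} (P? : Decidable P) where

    length-filter-++ : ∀ xs ys → length (filter P? (xs ++ ys)) ≡ length (filter P? xs) + length (filter P? ys)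
    length-filter-++ xs ys = trans (cong length (filter-++ P? xs ys)) (length-++ (filter P? xs))

    length-filter-↭ : ∀ {xs ys} → xs ↭ ys → length (filter P? xs) ≡ length (filter P? ys)
    length-filter-↭ xs↭ys = ↭-length (filter-↭ P? xs↭ys)

    filter-++-∁-↭ : ∀ xs → filter P? xs ++ filter (∁? P?) xs ↭ xs
    filter-++-∁-↭ xs = ↭-sym (subst (λ (ys , zs) → xs ↭ ys ++ zs) (partition-defn P? xs)
                                    (↭ₛ⇒↭ (Permutationₛ.partition-↭ (setoid A) P? xs)))

    module _ {Q : A → Set} (Q? : Decidable Q) where

      length-filter-mono : ∀ xs → (∀ {x} → x ∈ xs → P x → Q x) → length (filter P? xs) ≤ length (filter Q? xs)
      length-filter-mono []       _   = z≤n
      length-filter-mono (x ∷ xs) P⇒Q with P? x | Q? x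
      ... | yes _  | yes _  = s≤s (length-filter-mono xs (λ x∈ → P⇒Q (there x∈)))
      ... | yes px | no ¬qx = ⊥-elim (¬qx (P⇒Q (here refl) px))
      ... | no _   | yes _  = ℕ.m≤n⇒m≤1+n (length-filter-mono xs (λ x∈ → P⇒Q (there x∈)))
      ... | no _   | no _   = length-filter-mono xs (λ x∈ → P⇒Q (there x∈))

      length-filter-⊎ : ∀ xs →
        length (filter (λ x → P? x ⊎-dec Q? x) xs) ≤ length (filter P? xs) + length (filter Q? xs)
      length-filter-⊎ []       = z≤n
      length-filter-⊎ (x ∷ xs) with ih ← length-filter-⊎ xs | P? x | Q? x
      ... | yes _ | yes _ = s≤s (ℕ.≤-trans ih (ℕ.+-monoʳ-≤ (length (filter P? xs)) (ℕ.n≤1+n _)))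
      ... | yes _ | no _  = s≤s ih
      ... | no _  | yes _ = ℕ.≤-trans (s≤s ih) (ℕ.≤-reflexive (sym (ℕ.+-suc _ _)))
      ... | no _  | no _  = ih

  module _ {B : Set} (f : B → List A) {Q : B → Set} (Q? : Decidable Q) where

    length-filter≤1 : ∀ {x} bs → Unique (concat (map f bs)) → (∀ {b} → b ∈ bs → Q b → x ∈ f b) →
                      length (filter Q? bs) ≤ 1
    length-filter≤1 []       _  _    = z≤n
    length-filter≤1 (b ∷ bs) u! Q⇒∈ with Q? b
    ... | yes qb = s≤s (ℕ.≤-reflexive (cong length (filter-none Q? (All.tabulate notQ))))
      where
      notQ : ∀ {b′} → b′ ∈ bs → ¬ Q b′
      notQ b′∈ qb′ =
        Unique-++-disjoint (f b) u! (Q⇒∈ (here refl) qb) (∈-concat⁺′ (Q⇒∈ (there b′∈) qb′) (∈-map⁺ f b′∈))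
    ... | no _ = length-filter≤1 bs (Unique-++⁻ʳ (f b) u!) (λ b′∈ → Q⇒∈ (there b′∈))

  take-+ : ∀ a b (xs : List A) → take (a + b) xs ≡ take a xs ++ take b (drop a xs)
  take-+ zero    b xs       = refl
  take-+ (suc a) b []       = sym (take-[] b)
  take-+ (suc a) b (x ∷ xs) = cong (x ∷_) (take-+ a b xs)

  ≤-length-drop : ∀ a b (xs : List A) → a + b ≤ length xs → b ≤ length (drop a xs)
  ≤-length-drop a b xs a+b≤ =
    subst (b ≤_) (sym (length-drop a xs)) (ℕ.m+n≤o⇒m≤o∸n b (subst (_≤ length xs) (ℕ.+-comm a b) a+b≤))

  AllPairs-take-drop : ∀ {R : A → A → Set} a {xs x y} → AllPairs R xs → x ∈ take a xs → y ∈ drop a xs → R x y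
  AllPairs-take-drop (suc a) {_ ∷ xs} (x≺ ∷ _)      (here refl) y∈ = All.lookup x≺ (∈-drop a y∈)
    where
    ∈-drop : ∀ a {xs : List A} {y} → y ∈ drop a xs → y ∈ xs
    ∈-drop zero    y∈ = y∈
    ∈-drop (suc a) {_ ∷ _} y∈ = there (∈-drop a y∈)
  AllPairs-take-drop (suc a) {_ ∷ xs} (_ ∷ sorted) (there x∈) y∈ = AllPairs-take-drop a sorted x∈ y∈

  ∈-concat-unique⇒≡ : ∀ {B : Set} (f : B → List A) {bs b b′ x} → Unique (concat (map f bs)) →
                      b ∈ bs → b′ ∈ bs → x ∈ f b → x ∈ f b′ → b ≡ b′
  ∈-concat-unique⇒≡ f             u! (here refl) (here refl) _ _ = refl
  ∈-concat-unique⇒≡ f {b ∷ _}     u! (here refl) (there b′∈) x∈ x∈′ =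
    ⊥-elim (Unique-++-disjoint (f b) u! x∈ (∈-concat⁺′ x∈′ (∈-map⁺ f b′∈)))
  ∈-concat-unique⇒≡ f {b′ ∷ _}    u! (there b∈) (here refl) x∈ x∈′ =
    ⊥-elim (Unique-++-disjoint (f b′) u! x∈′ (∈-concat⁺′ x∈ (∈-map⁺ f b∈)))
  ∈-concat-unique⇒≡ f {b₀ ∷ _}    u! (there b∈) (there b′∈) x∈ x∈′ =
    ∈-concat-unique⇒≡ f (Unique-++⁻ʳ (f b₀) u!) b∈ b′∈ x∈ x∈′

-- Subtrees and most recent common ancestors

module _ {k : ℕ} where

  infix 4 _⊑_

  data _⊑_ : BTree k → BTree k → Set where
    ⊑-refl  : ∀ {t} → t ⊑ t
    ⊑-left  : ∀ {s q l r} → s ⊑ l → s ⊑ node q l r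
    ⊑-right : ∀ {s q l r} → s ⊑ r → s ⊑ node q l r

  ⊑-trans : ∀ {s t u : BTree k} → s ⊑ t → t ⊑ u → s ⊑ u
  ⊑-trans s⊑t ⊑-refl      = s⊑t
  ⊑-trans s⊑t (⊑-left p)  = ⊑-left (⊑-trans s⊑t p)
  ⊑-trans s⊑t (⊑-right p) = ⊑-right (⊑-trans s⊑t p)

  ∈-leaves-⊑ : ∀ {s t : BTree k} {x} → s ⊑ t → x ∈ leaves s → x ∈ leaves t
  ∈-leaves-⊑ ⊑-refl x∈ = x∈
  ∈-leaves-⊑ (⊑-left p) x∈ = ∈-++⁺ˡ (∈-leaves-⊑ p x∈)
  ∈-leaves-⊑ {t = node _ l _} (⊑-right p) x∈ = ∈-++⁺ʳ (leaves l) (∈-leaves-⊑ p x∈)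

  MonotoneTimes-⊑ : ∀ {s t : BTree k} → s ⊑ t → MonotoneTimes t → MonotoneTimes s
  MonotoneTimes-⊑ ⊑-refl      mono                = mono
  MonotoneTimes-⊑ (⊑-left p)  (_ , _ , monoˡ , _) = MonotoneTimes-⊑ p monoˡ
  MonotoneTimes-⊑ (⊑-right p) (_ , _ , _ , monoʳ) = MonotoneTimes-⊑ p monoʳ

  0≤rootTime : ∀ (t : BTree k) → MonotoneTimes t → 0ℚ ℚ.≤ rootTime t
  0≤rootTime (leaf _)     _                   = ℚₚ.≤-refl
  0≤rootTime (node _ l _) (l≤q , _ , monoˡ , _) = ℚₚ.≤-trans (0≤rootTime l monoˡ) l≤q

  _∈ᶠ?_ : ∀ (x : Fin k) xs → Dec (x ∈ xs)
  x ∈ᶠ? xs = Any.any? (x ≟ᶠ_) xs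

  elemB⇒∈ : ∀ {x : Fin k} xs → elemB x xs ≡ true → x ∈ xs
  elemB⇒∈ {x} (y ∷ xs) e with y ≟ᶠ x
  ... | yes refl = here refl
  ... | no _     = there (elemB⇒∈ xs e)

  ∈⇒elemB : ∀ {x : Fin k} {xs} → x ∈ xs → elemB x xs ≡ true
  ∈⇒elemB {x} {y ∷ xs} x∈ with y ≟ᶠ x | x∈
  ... | yes _  | _          = refl
  ... | no y≢x | here x≡y   = ⊥-elim (y≢x (sym x≡y))
  ... | no _   | there x∈xs = ∈⇒elemB x∈xs

  ∉⇒elemB : ∀ {x : Fin k} xs → x ∉ xs → elemB x xs ≡ false
  ∉⇒elemB {x} xs x∉ with elemB x xs in e
  ... | false = refl
  ... | true  = ⊥-elim (x∉ (elemB⇒∈ xs e))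

  elemB-∧⇒∈ : ∀ {i j : Fin k} xs → elemB i xs ∧ elemB j xs ≡ true → i ∈ xs × j ∈ xs
  elemB-∧⇒∈ {i} {j} xs e with elemB i xs in ei | elemB j xs in ej
  ... | true | true = elemB⇒∈ xs ei , elemB⇒∈ xs ej

  lcaTime-attained : ∀ (t : BTree k) {i j} → i ∈ leaves t → j ∈ leaves t →
    ∃[ s ] s ⊑ t × i ∈ leaves s × j ∈ leaves s × lcaTime t i j ≡ rootTime s
  lcaTime-attained (leaf a) i∈ j∈ = leaf a , ⊑-refl , i∈ , j∈ , refl
  lcaTime-attained (node q l r) {i} {j} i∈ j∈ with elemB i (leaves l) ∧ elemB j (leaves l) in inˡ
  ... | true
    with s , s⊑l , rest ← uncurry (lcaTime-attained l) (elemB-∧⇒∈ (leaves l) inˡ)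
       = s , ⊑-left s⊑l , rest
  ... | false with elemB i (leaves r) ∧ elemB j (leaves r) in inʳ
  ...   | true
    with s , s⊑r , rest ← uncurry (lcaTime-attained r) (elemB-∧⇒∈ (leaves r) inʳ)
       = s , ⊑-right s⊑r , rest
  ...   | false = node q l r , ⊑-refl , i∈ , j∈ , refl

  lcaTime≤rootTime : ∀ (t : BTree k) i j → MonotoneTimes t → lcaTime t i j ℚ.≤ rootTime t
  lcaTime≤rootTime (leaf _) _ _ _ = ℚₚ.≤-refl
  lcaTime≤rootTime (node q l r) i j (l≤q , r≤q , monoˡ , monoʳ)
    with elemB i (leaves l) ∧ elemB j (leaves l)
  ... | true = ℚₚ.≤-trans (lcaTime≤rootTime l i j monoˡ) l≤q
  ... | false with elemB i (leaves r) ∧ elemB j (leaves r)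
  ...   | true  = ℚₚ.≤-trans (lcaTime≤rootTime r i j monoʳ) r≤q
  ...   | false = ℚₚ.≤-refl

  lcaTime-left : ∀ {q} {l r : BTree k} {i j} → i ∈ leaves l → j ∈ leaves l →
                 lcaTime (node q l r) i j ≡ lcaTime l i j
  lcaTime-left i∈ j∈ rewrite ∈⇒elemB i∈ | ∈⇒elemB j∈ = refl

  lcaTime-right : ∀ {q} {l r : BTree k} {i j} → i ∉ leaves l → i ∈ leaves r → j ∈ leaves r →
                  lcaTime (node q l r) i j ≡ lcaTime r i j
  lcaTime-right {l = l} i∉ i∈ j∈ rewrite ∉⇒elemB (leaves l) i∉ | ∈⇒elemB i∈ | ∈⇒elemB j∈ = refl

  lcaTime≤rootTime-⊑ : ∀ {s t : BTree k} {i j} → Unique (leaves t) → MonotoneTimes t → s ⊑ t →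
                       i ∈ leaves s → j ∈ leaves s → lcaTime t i j ℚ.≤ rootTime s
  lcaTime≤rootTime-⊑ {t = t} {i} {j} _ mono ⊑-refl _ _ = lcaTime≤rootTime t i j mono
  lcaTime≤rootTime-⊑ {t = node q l r} u! (_ , _ , monoˡ , _) (⊑-left p) i∈ j∈ =
    ℚₚ.≤-trans (ℚₚ.≤-reflexive (lcaTime-left {q} {l} {r} (∈-leaves-⊑ p i∈) (∈-leaves-⊑ p j∈)))
               (lcaTime≤rootTime-⊑ (Unique-++⁻ˡ (leaves l) u!) monoˡ p i∈ j∈)
  lcaTime≤rootTime-⊑ {t = node q l r} u! (_ , _ , _ , monoʳ) (⊑-right p) i∈ j∈ =
    ℚₚ.≤-trans (ℚₚ.≤-reflexive (lcaTime-right {q} {l} {r} i∉l (∈-leaves-⊑ p i∈) (∈-leaves-⊑ p j∈)))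
               (lcaTime≤rootTime-⊑ (Unique-++⁻ʳ (leaves l) u!) monoʳ p i∈ j∈)
    where
    i∉l : _ ∉ leaves l
    i∉l i∈l = Unique-++-disjoint (leaves l) u! i∈l (∈-leaves-⊑ p i∈)

-- Clusters below a time threshold

countAtMost : ℚ → List ℚ → ℕ
countAtMost τ qs = length (filter (λ q → q ℚₚ.≤? τ) qs)

module _ {k : ℕ} where

  suc-length-internalTimes : ∀ (t : BTree k) → suc (length (internalTimes t)) ≡ length (leaves t)
  suc-length-internalTimes (leaf _) = refl
  suc-length-internalTimes (node _ l r) = begin
    suc (suc (length (internalTimes l ++ internalTimes r)))    ≡⟨ cong (λ x → suc (suc x)) (length-++ (internalTimes l)) ⟩
    suc (suc (length (internalTimes l) + length (internalTimes r))) ≡⟨ cong suc (sym (ℕ.+-suc _ _)) ⟩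
    suc (length (internalTimes l)) + suc (length (internalTimes r))
      ≡⟨ cong₂ _+_ (suc-length-internalTimes l) (suc-length-internalTimes r) ⟩
    length (leaves l) + length (leaves r)                       ≡⟨ sym (length-++ (leaves l)) ⟩
    length (leaves l ++ leaves r)                               ∎
    where open ≡-Reasoning

  internalTimes≤ : ∀ (t : BTree k) {τ} → MonotoneTimes t → rootTime t ℚ.≤ τ → All (ℚ._≤ τ) (internalTimes t)
  internalTimes≤ (leaf _) _ _ = []
  internalTimes≤ (node q l r) (l≤q , r≤q , monoˡ , monoʳ) q≤τ =
    q≤τ ∷ All.++⁺ (internalTimes≤ l monoˡ (ℚₚ.≤-trans l≤q q≤τ))
                  (internalTimes≤ r monoʳ (ℚₚ.≤-trans r≤q q≤τ))

  countAtMost-node : ∀ {τ q} (l r : BTree k) → ¬ q ℚ.≤ τ →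
    countAtMost τ (internalTimes (node q l r)) ≡ countAtMost τ (internalTimes l) + countAtMost τ (internalTimes r)
  countAtMost-node {τ} l r q≰τ =
    trans (cong length (filter-reject (λ q → q ℚₚ.≤? τ) q≰τ))
          (length-filter-++ (λ q → q ℚₚ.≤? τ) (internalTimes l) _)

  clusters : ℚ → BTree k → List (BTree k)
  clusters τ (leaf a) = leaf a ∷ []
  clusters τ (node q l r) with q ℚₚ.≤? τ
  ... | yes _ = node q l r ∷ []
  ... | no  _ = clusters τ l ++ clusters τ r

  length-clusters : ∀ τ (t : BTree k) → MonotoneTimes t →
    length (clusters τ t) + countAtMost τ (internalTimes t) ≡ length (leaves t)
  length-clusters τ (leaf _) _ = refl
  length-clusters τ (node q l r) mono@(_ , _ , monoˡ , monoʳ) with q ℚₚ.≤? τ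
  ... | yes q≤τ =
    trans (cong (λ xs → suc (length xs)) (filter-all (λ q → q ℚₚ.≤? τ) (internalTimes≤ (node q l r) mono q≤τ)))
          (suc-length-internalTimes (node q l r))
  ... | no q≰τ = begin
    length (clusters τ l ++ clusters τ r) + countAtMost τ (internalTimes (node q l r))
      ≡⟨ cong₂ _+_ (length-++ (clusters τ l)) (countAtMost-node l r q≰τ) ⟩
    (#Cˡ + #Cʳ) + (#τˡ + #τʳ)  ≡⟨ interchange #Cˡ #Cʳ #τˡ #τʳ ⟩
    (#Cˡ + #τˡ) + (#Cʳ + #τʳ)  ≡⟨ cong₂ _+_ (length-clusters τ l monoˡ) (length-clusters τ r monoʳ) ⟩
    length (leaves l) + length (leaves r) ≡⟨ sym (length-++ (leaves l)) ⟩
    length (leaves l ++ leaves r) ∎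
    where
    open ≡-Reasoning
    #Cˡ = length (clusters τ l)
    #Cʳ = length (clusters τ r)
    #τˡ = countAtMost τ (internalTimes l)
    #τʳ = countAtMost τ (internalTimes r)

  concat-leaves-clusters : ∀ τ (t : BTree k) → concat (map leaves (clusters τ t)) ≡ leaves t
  concat-leaves-clusters τ (leaf _) = refl
  concat-leaves-clusters τ (node q l r) with q ℚₚ.≤? τ
  ... | yes _ = ++-identityʳ _
  ... | no  _ = begin
    concat (map leaves (clusters τ l ++ clusters τ r))
      ≡⟨ cong concat (map-++ leaves (clusters τ l) (clusters τ r)) ⟩
    concat (map leaves (clusters τ l) ++ map leaves (clusters τ r))
      ≡⟨ sym (concat-++ (map leaves (clusters τ l)) _) ⟩
    concat (map leaves (clusters τ l)) ++ concat (map leaves (clusters τ r))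
      ≡⟨ cong₂ _++_ (concat-leaves-clusters τ l) (concat-leaves-clusters τ r) ⟩
    leaves l ++ leaves r ∎
    where open ≡-Reasoning

  ⊑-cluster : ∀ {τ} {u t : BTree k} → u ⊑ t → rootTime u ℚ.≤ τ → ∃[ C ] C ∈ clusters τ t × u ⊑ C
  ⊑-cluster {t = leaf a} ⊑-refl _ = leaf a , here refl , ⊑-refl
  ⊑-cluster {τ} {t = node q l r} u⊑t u≤τ with q ℚₚ.≤? τ | u⊑t
  ... | yes _   | _ = node q l r , here refl , u⊑t
  ... | no q≰τ  | ⊑-refl = ⊥-elim (q≰τ u≤τ)
  ... | no _    | ⊑-left p  with C , C∈ , u⊑C ← ⊑-cluster p u≤τ = C , ∈-++⁺ˡ C∈ , u⊑C
  ... | no _    | ⊑-right p with C , C∈ , u⊑C ← ⊑-cluster p u≤τ = C , ∈-++⁺ʳ (clusters τ l) C∈ , u⊑C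

  someLeaf : ∀ (t : BTree k) → ∃[ x ] x ∈ leaves t
  someLeaf (leaf x)     = x , here refl
  someLeaf (node _ l _) with x , x∈ ← someLeaf l = x , ∈-++⁺ˡ x∈

module _ {k : ℕ} {Q : Fin k → Set} (Q? : Decidable Q) {M : BTree k → Set} (M? : Decidable M)
         (Q⇒M : ∀ {C y} → y ∈ leaves C → Q y → M C) (τ : ℚ) where

  length-filter-leaves≤ : ∀ t → MonotoneTimes t →
    length (filter Q? (leaves t)) ≤ length (filter M? (clusters τ t)) + countAtMost τ (internalTimes t)
  length-filter-leaves≤ (leaf y) _ with Q? y | M? (leaf y)
  ... | no _   | _     = z≤n
  ... | yes _  | yes _ = s≤s z≤n
  ... | yes qy | no ¬m = ⊥-elim (¬m (Q⇒M (here refl) qy))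
  length-filter-leaves≤ t@(node q l r) mono@(_ , _ , monoˡ , monoʳ) with q ℚₚ.≤? τ
  ... | yes q≤τ with M? t
  ...   | yes _ = begin
    length (filter Q? (leaves t))          ≤⟨ length-filter Q? (leaves t) ⟩
    length (leaves t)                      ≡⟨ sym (suc-length-internalTimes t) ⟩
    suc (length (internalTimes t))
      ≡⟨ cong (suc ∘ length) (filter-all (λ q → q ℚₚ.≤? τ) (internalTimes≤ t mono q≤τ)) ⟨
    suc (countAtMost τ (internalTimes t))  ∎
    where open ℕ.≤-Reasoning
  ...   | no ¬m =
    ℕ.≤-trans (ℕ.≤-reflexive (cong length (filter-none Q? (All.tabulate (λ y∈ qy → ¬m (Q⇒M y∈ qy)))))) z≤n
  length-filter-leaves≤ (node q l r) (_ , _ , monoˡ , monoʳ) | no q≰τ = begin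
    length (filter Q? (leaves l ++ leaves r))   ≡⟨ length-filter-++ Q? (leaves l) (leaves r) ⟩
    #Qˡ + #Qʳ
      ≤⟨ ℕ.+-mono-≤ (length-filter-leaves≤ l monoˡ) (length-filter-leaves≤ r monoʳ) ⟩
    (#Mˡ + #τˡ) + (#Mʳ + #τʳ)                   ≡⟨ interchange #Mˡ #τˡ #Mʳ #τʳ ⟩
    (#Mˡ + #Mʳ) + (#τˡ + #τʳ)
      ≡⟨ cong₂ _+_ (length-filter-++ M? (clusters τ l) _) (countAtMost-node l r q≰τ) ⟨
    length (filter M? (clusters τ l ++ clusters τ r)) + countAtMost τ (internalTimes (node q l r)) ∎
    where
    open ℕ.≤-Reasoning
    #Qˡ = length (filter Q? (leaves l))
    #Qʳ = length (filter Q? (leaves r))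
    #Mˡ = length (filter M? (clusters τ l))
    #Mʳ = length (filter M? (clusters τ r))
    #τˡ = countAtMost τ (internalTimes l)
    #τʳ = countAtMost τ (internalTimes r)

-- Counting clusters of a nested pair

module _ {k : ℕ} {t : BTree k} (ultra : UltraBinTree k t) where

  Unique-leaves : Unique (leaves t)
  Unique-leaves = Unique-resp-↭ (↭-sym (proj₁ ultra)) (allFin⁺ k)

  ∈-leaves : ∀ x → x ∈ leaves t
  ∈-leaves x = ∈-resp-↭ (↭-sym (proj₁ ultra)) (∈-allFin x)

p+p≤q+q⇒p≤q : ∀ {p q : ℚ} → p ℚ.+ p ℚ.≤ q ℚ.+ q → p ℚ.≤ q
p+p≤q+q⇒p≤q {p} {q} p+p≤q+q with p ℚₚ.≤? q
... | yes p≤q = p≤q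
... | no  p≰q = ⊥-elim (ℚₚ.<-irrefl refl (ℚₚ.≤-<-trans p+p≤q+q (ℚₚ.+-mono-< q<p q<p)))
  where q<p = ℚₚ.≰⇒> p≰q

module _ {n m : ℕ} (ℓ : Fin m → Fin n) where

  Meets : List (Fin m) → BTree n → Set
  Meets js C = Any (λ j → ℓ j ∈ leaves C) js

  meets? : ∀ js → Decidable (Meets js)
  meets? js C = Any.any? (λ j → ℓ j ∈ᶠ? leaves C) js

  image? : Decidable (λ y → ∃[ x ] ℓ x ≡ y)
  image? y = any? (λ x → ℓ x ≟ᶠ y)

  module _ {tH : BTree n} {tP : BTree m} (ultraH : UltraBinTree n tH) (ultraP : UltraBinTree m tP)
           (nests : Nests ℓ tH tP) (τ : ℚ) where

    private
      uniqueClusters : Unique (concat (map leaves (clusters τ tH)))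
      uniqueClusters = subst Unique (sym (concat-leaves-clusters τ tH)) (Unique-leaves ultraH)

    lcaTimeH≤rootTime-⊑ : ∀ {s j j′} → s ⊑ tP → j ∈ leaves s → j′ ∈ leaves s →
                          lcaTime tH (ℓ j) (ℓ j′) ℚ.≤ rootTime s
    lcaTimeH≤rootTime-⊑ {j = j} {j′} s⊑tP j∈ j′∈ =
        ℚₚ.≤-trans (p+p≤q+q⇒p≤q (nests j j′))
                 (lcaTime≤rootTime-⊑ (Unique-leaves ultraP) (proj₂ ultraP) s⊑tP j∈ j′∈)

    sameCluster : ∀ {s j j′} → s ⊑ tP → rootTime s ℚ.≤ τ → j ∈ leaves s → j′ ∈ leaves s →
                  ∃[ C ] C ∈ clusters τ tH × ℓ j ∈ leaves C × ℓ j′ ∈ leaves C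
    sameCluster {s} {j} {j′} s⊑tP s≤τ j∈ j′∈
      with u , u⊑tH , ℓj∈u , ℓj′∈u , lcaH≡u
             ← lcaTime-attained tH (∈-leaves ultraH (ℓ j)) (∈-leaves ultraH (ℓ j′))
      with C , C∈ , u⊑C ← ⊑-cluster u⊑tH
             (subst (ℚ._≤ τ) lcaH≡u (ℚₚ.≤-trans (lcaTimeH≤rootTime-⊑ s⊑tP j∈ j′∈) s≤τ))
      = C , C∈ , ∈-leaves-⊑ u⊑C ℓj∈u , ∈-leaves-⊑ u⊑C ℓj′∈u

    meets⇒∈cluster : ∀ {s C j₀} → s ⊑ tP → rootTime s ℚ.≤ τ → j₀ ∈ leaves s →
                     C ∈ clusters τ tH → Meets (leaves s) C → ℓ j₀ ∈ leaves C
    meets⇒∈cluster {j₀ = j₀} s⊑tP s≤τ j₀∈ C∈ meets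
      with j , j∈ , ℓj∈C ← find meets
      with C′ , C′∈ , ℓj∈C′ , ℓj₀∈C′ ← sameCluster s⊑tP s≤τ j∈ j₀∈
      with refl ← ∈-concat-unique⇒≡ leaves uniqueClusters C∈ C′∈ ℓj∈C ℓj∈C′
      = ℓj₀∈C′

    clustersMeeting≤clusters : ∀ {s} → s ⊑ tP →
      length (filter (meets? (leaves s)) (clusters τ tH)) ≤ length (clusters τ s)
    clustersMeeting≤clusters {leaf j} _ =
      length-filter≤1 leaves (meets? (j ∷ [])) (clusters τ tH) uniqueClusters λ where
        _ (here ℓj∈C) → ℓj∈C
    clustersMeeting≤clusters {node q l r} s⊑tP with q ℚₚ.≤? τ
    ... | yes q≤τ = let j₀ , j₀∈ = someLeaf (node q l r) in
      length-filter≤1 leaves (meets? (leaves (node q l r))) (clusters τ tH) uniqueClusters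
        (λ C∈ meets → meets⇒∈cluster s⊑tP q≤τ j₀∈ C∈ meets)
    ... | no _ = begin
      length (filter (meets? (leaves l ++ leaves r)) Cs)
        ≤⟨ length-filter-mono (meets? (leaves l ++ leaves r)) (λ C → meets? (leaves l) C ⊎-dec meets? (leaves r) C) Cs
             (λ _ → Any.++⁻ (leaves l)) ⟩
      length (filter (λ C → meets? (leaves l) C ⊎-dec meets? (leaves r) C) Cs)
        ≤⟨ length-filter-⊎ (meets? (leaves l)) (meets? (leaves r)) Cs ⟩
      length (filter (meets? (leaves l)) Cs) + length (filter (meets? (leaves r)) Cs)
        ≤⟨ ℕ.+-mono-≤ (clustersMeeting≤clusters (⊑-trans (⊑-left ⊑-refl) s⊑tP))
                      (clustersMeeting≤clusters (⊑-trans (⊑-right ⊑-refl) s⊑tP)) ⟩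
      length (clusters τ l) + length (clusters τ r)
        ≡⟨ length-++ (clusters τ l) ⟨
      length (clusters τ l ++ clusters τ r) ∎
      where
      open ℕ.≤-Reasoning
      Cs = clusters τ tH

    countAtMost-nested : countAtMost τ (internalTimes tP) + imageSize ℓ ≤ countAtMost τ (internalTimes tH) + m
    countAtMost-nested = begin
      #P + imageSize ℓ
        ≡⟨ cong (#P +_) (length-filter-↭ image? (proj₁ ultraH)) ⟨
      #P + length (filter image? (leaves tH))
        ≤⟨ ℕ.+-monoʳ-≤ #P
             (length-filter-leaves≤ image? (meets? (leaves tP)) (λ {C} → image⇒meets {C}) τ tH (proj₂ ultraH)) ⟩
      #P + (length (filter (meets? (leaves tP)) (clusters τ tH)) + #H)
        ≤⟨ ℕ.+-monoʳ-≤ #P (ℕ.+-monoˡ-≤ #H (clustersMeeting≤clusters ⊑-refl)) ⟩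
      #P + (length (clusters τ tP) + #H)
        ≡⟨ ℕ.+-assoc #P _ #H ⟨
      (#P + length (clusters τ tP)) + #H
        ≡⟨ cong (_+ #H) (trans (ℕ.+-comm #P _) (length-clusters τ tP (proj₂ ultraP))) ⟩
      length (leaves tP) + #H
        ≡⟨ cong (_+ #H) (trans (↭-length (proj₁ ultraP)) (length-tabulate (λ j → j))) ⟩
      m + #H
        ≡⟨ ℕ.+-comm m #H ⟩
      #H + m ∎
      where
      open ℕ.≤-Reasoning
      #P = countAtMost τ (internalTimes tP)
      #H = countAtMost τ (internalTimes tH)
      image⇒meets : ∀ {C y} → y ∈ leaves C → ∃[ x ] ℓ x ≡ y → Meets (leaves tP) C
      image⇒meets y∈C (x , refl) = lose (∈-leaves ultraP x) y∈C

-- Prefixes of a nesting sequence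

m+n≤o+p⇒m≤o+[p∸n] : ∀ m n o p → m + n ≤ o + p → m ≤ o + (p ∸ n)
m+n≤o+p⇒m≤o+[p∸n] m n o p m+n≤o+p = begin
  m                          ≤⟨ ℕ.m+n≤o⇒m≤o∸n m (ℕ.≤-trans m+n≤o+p o+p≤n+[o+[p∸n]]) ⟩
  n + (o + (p ∸ n)) ∸ n      ≡⟨ ℕ.m+n∸m≡n n _ ⟩
  o + (p ∸ n)                ∎
  where
  open ℕ.≤-Reasoning
  o+p≤n+[o+[p∸n]] : o + p ≤ n + (o + (p ∸ n))
  o+p≤n+[o+[p∸n]] = ℕ.≤-trans (ℕ.+-monoʳ-≤ o (ℕ.m≤n+m∸n p n)) (ℕ.≤-reflexive (x∙yz≈y∙xz o n (p ∸ n)))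

_<ₜ_ : Letter × ℚ → Letter × ℚ → Set
x <ₜ y = proj₂ x ℚ.< proj₂ y

All-timesOf : ∀ {Q : ℚ → Set} c xs → All (Q ∘ proj₂) xs → All Q (timesOf c xs)
All-timesOf c [] [] = []
All-timesOf H ((H , _) ∷ xs) (q ∷ qs) = q ∷ All-timesOf H xs qs
All-timesOf H ((P , _) ∷ xs) (_ ∷ qs) = All-timesOf H xs qs
All-timesOf P ((H , _) ∷ xs) (_ ∷ qs) = All-timesOf P xs qs
All-timesOf P ((P , _) ∷ xs) (q ∷ qs) = q ∷ All-timesOf P xs qs

count-∷ : ∀ c c′ w → count c (c′ ∷ w) ≡ count c (c′ ∷ []) + count c w
count-∷ H H _ = refl
count-∷ H P _ = refl
count-∷ P H _ = refl
count-∷ P P _ = refl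

countAtMost-timesOf-∷ : ∀ {τ t} c c′ xs → t ℚ.≤ τ →
  countAtMost τ (timesOf c ((c′ , t) ∷ xs)) ≡ count c (c′ ∷ []) + countAtMost τ (timesOf c xs)
countAtMost-timesOf-∷ {τ} H H _ t≤τ = cong length (filter-accept (λ q → q ℚₚ.≤? τ) t≤τ)
countAtMost-timesOf-∷ H P _ _ = refl
countAtMost-timesOf-∷ P H _ _ = refl
countAtMost-timesOf-∷ {τ} P P _ t≤τ = cong length (filter-accept (λ q → q ℚₚ.≤? τ) t≤τ)

countAtMost-timesOf-above : ∀ {τ} c xs → All (λ x → τ ℚ.< proj₂ x) xs → countAtMost τ (timesOf c xs) ≡ 0
countAtMost-timesOf-above {τ} c xs τ< =
  cong length (filter-none (λ q → q ℚₚ.≤? τ) (All.map (λ τ<q q≤τ → ℚₚ.<-irrefl refl (ℚₚ.<-≤-trans τ<q q≤τ))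
                                                     (All-timesOf c xs τ<)))

-- In a time-sorted list, the first k+1 entries are exactly those whose time is at most that of entry k.
prefix-countAtMost : ∀ xs → AllPairs _<ₜ_ xs → ∀ k → k < length xs →
  ∃[ τ ] τ ∈ map proj₂ xs × (∀ c → count c (take (suc k) (map proj₁ xs)) ≡ countAtMost τ (timesOf c xs))
prefix-countAtMost ((c′ , t) ∷ xs) (t< ∷ _) zero _ =
  t , here refl , λ c → begin
    count c (c′ ∷ [])                               ≡⟨ ℕ.+-identityʳ _ ⟨
    count c (c′ ∷ []) + 0                            ≡⟨ cong (count c (c′ ∷ []) +_) (countAtMost-timesOf-above c xs t<) ⟨
    count c (c′ ∷ []) + countAtMost t (timesOf c xs) ≡⟨ countAtMost-timesOf-∷ c c′ xs ℚₚ.≤-refl ⟨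
    countAtMost t (timesOf c ((c′ , t) ∷ xs))        ∎
  where open ≡-Reasoning
prefix-countAtMost ((c′ , t) ∷ xs) (t< ∷ sorted) (suc k) (s≤s k<)
  with τ , τ∈ , prefix≡ ← prefix-countAtMost xs sorted k k< =
  τ , there τ∈ , λ c → begin
    count c (c′ ∷ take (suc k) (map proj₁ xs))               ≡⟨ count-∷ c c′ _ ⟩
    count c (c′ ∷ []) + count c (take (suc k) (map proj₁ xs)) ≡⟨ cong (count c (c′ ∷ []) +_) (prefix≡ c) ⟩
    count c (c′ ∷ []) + countAtMost τ (timesOf c xs)           ≡⟨ countAtMost-timesOf-∷ c c′ xs t≤τ ⟨
    countAtMost τ (timesOf c ((c′ , t) ∷ xs))                  ∎
  where
  open ≡-Reasoning
  t≤τ : t ℚ.≤ τ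
  t≤τ = ℚₚ.<⇒≤ (All.lookup (All.map⁺ t<) τ∈)

PrefixBound : ∀ {N} → ℕ → Vec Letter N → Set
PrefixBound {N} d S = ∀ (i : Fin N) →
  count P (take (suc (toℕ i)) (toList S)) ≤ count H (take (suc (toℕ i)) (toList S)) + d

admissible⇒prefixBound : ∀ {n m} (ℓ : Fin m → Fin n) {N} (S : Vec Letter N) →
  Admissible n m ℓ (toList S) → PrefixBound (m ∸ imageSize ℓ) S
admissible⇒prefixBound {m = m} ℓ S (tH , tP , ultraH , ultraP , nests , _ , xs , xs↦S , sorted , timesH , timesP) i =
  bound (prefix-countAtMost xs (Linkedₚ.Linked⇒AllPairs (λ {a b c} → ℚₚ.<-trans) sorted) k k<length)
  where
  k = toℕ i
  d = m ∸ imageSize ℓ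

  k<length : k < length xs
  k<length = subst (k <_) (trans (sym (length-toList S)) (trans (cong length (sym xs↦S)) (length-map proj₁ xs))) (toℕ<n i)

  bound : ∃[ τ ] τ ∈ map proj₂ xs ×
                  (∀ c → count c (take (suc k) (map proj₁ xs)) ≡ countAtMost τ (timesOf c xs)) →
          count P (take (suc k) (toList S)) ≤ count H (take (suc k) (toList S)) + d
  bound (τ , _ , prefix≡) = begin
    count P (take (suc k) (toList S))      ≡⟨ trans (cong (count P ∘ take (suc k)) (sym xs↦S)) (prefix≡ P) ⟩
    countAtMost τ (timesOf P xs)           ≡⟨ length-filter-↭ (λ q → q ℚₚ.≤? τ) timesP ⟩
    countAtMost τ (internalTimes tP)       ≤⟨ m+n≤o+p⇒m≤o+[p∸n] _ _ _ _ (countAtMost-nested ℓ ultraH ultraP nests τ) ⟩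
    countAtMost τ (internalTimes tH) + d   ≡⟨ cong (_+ d) (length-filter-↭ (λ q → q ℚₚ.≤? τ) timesH) ⟨
    countAtMost τ (timesOf H xs) + d       ≡⟨ cong (_+ d) (trans (cong (count H ∘ take (suc k)) (sym xs↦S)) (prefix≡ H)) ⟨
    count H (take (suc k) (toList S)) + d  ∎
    where open ℕ.≤-Reasoning

-- Ballot words

infixr 5 H∷_ P∷_

-- Ballot d w: in every prefix of w the P's outnumber the H's by at most d.
data Ballot : ℕ → List Letter → Set where
  []   : ∀ {d} → Ballot d []
  H∷_  : ∀ {d w} → Ballot (suc d) w → Ballot d (H ∷ w)
  P∷_  : ∀ {d w} → Ballot d w → Ballot (suc d) (P ∷ w)

prefixBound⇒Ballot : ∀ {N} d (S : Vec Letter N) → PrefixBound d S → Ballot d (toList S)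
prefixBound⇒Ballot d       []      _     = []
prefixBound⇒Ballot d       (H ∷ S) bound =
  H∷ prefixBound⇒Ballot (suc d) S (λ i → ℕ.≤-trans (bound (suc i)) (ℕ.≤-reflexive (sym (ℕ.+-suc _ d))))
prefixBound⇒Ballot zero    (P ∷ S) bound with () ← bound zero
prefixBound⇒Ballot (suc d) (P ∷ S) bound =
  P∷ prefixBound⇒Ballot d S (λ i → ℕ.≤-pred (ℕ.≤-trans (bound (suc i)) (ℕ.≤-reflexive (ℕ.+-suc _ d))))

AllPairs-timesOf : ∀ c {xs} → AllPairs _<ₜ_ xs → AllPairs ℚ._<_ (timesOf c xs)
AllPairs-timesOf c {[]} [] = []
AllPairs-timesOf H {(H , _) ∷ xs} (t< ∷ sorted) = All-timesOf H xs t< ∷ AllPairs-timesOf H sorted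
AllPairs-timesOf H {(P , _) ∷ xs} (_  ∷ sorted) = AllPairs-timesOf H sorted
AllPairs-timesOf P {(H , _) ∷ xs} (_  ∷ sorted) = AllPairs-timesOf P sorted
AllPairs-timesOf P {(P , _) ∷ xs} (t< ∷ sorted) = All-timesOf P xs t< ∷ AllPairs-timesOf P sorted

length-timesOf : ∀ c xs → length (timesOf c xs) ≡ count c (map proj₁ xs)
length-timesOf H [] = refl
length-timesOf P [] = refl
length-timesOf H ((H , _) ∷ xs) = cong suc (length-timesOf H xs)
length-timesOf H ((P , _) ∷ xs) = length-timesOf H xs
length-timesOf P ((H , _) ∷ xs) = length-timesOf P xs
length-timesOf P ((P , _) ∷ xs) = cong suc (length-timesOf P xs)

timesOf-++-↭ : ∀ xs → timesOf H xs ++ timesOf P xs ↭ map proj₂ xs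
timesOf-++-↭ []             = ↭-refl
timesOf-++-↭ ((H , t) ∷ xs) = prep t (timesOf-++-↭ xs)
timesOf-++-↭ ((P , t) ∷ xs) = ↭-trans (shift t (timesOf H xs) (timesOf P xs)) (prep t (timesOf-++-↭ xs))

Unique-timesOf-++ : ∀ {xs} → AllPairs _<ₜ_ xs → Unique (timesOf H xs ++ timesOf P xs)
Unique-timesOf-++ {xs} sorted =
  Unique-resp-↭ (↭-sym (timesOf-++-↭ xs)) (AllPairs.map⁺ (AllPairs.map ℚₚ.<⇒≢ sorted))

infix 4 _≤ₚ_

data _≤ₚ_ : List ℚ → List ℚ → Set where
  []  : ∀ {hs} → hs ≤ₚ []
  _∷_ : ∀ {h p hs ps} → h ℚ.≤ p → hs ≤ₚ ps → h ∷ hs ≤ₚ p ∷ ps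

∷-≤ₚ-drop : ∀ d {h hs ps} → All (h ℚ.<_) ps → hs ≤ₚ drop (suc d) ps → h ∷ hs ≤ₚ drop d ps
∷-≤ₚ-drop zero    {ps = []}     _          _  = []
∷-≤ₚ-drop zero    {ps = p ∷ ps} (h<p ∷ _)  hs≤ = ℚₚ.<⇒≤ h<p ∷ hs≤
∷-≤ₚ-drop (suc d) {ps = []}     _          _  = []
∷-≤ₚ-drop (suc d) {ps = p ∷ ps} (_ ∷ h<ps) hs≤ = ∷-≤ₚ-drop d h<ps hs≤

Ballot⇒≤ₚ : ∀ {d} xs → AllPairs _<ₜ_ xs → Ballot d (map proj₁ xs) → timesOf H xs ≤ₚ drop d (timesOf P xs)
Ballot⇒≤ₚ {d} [] _ [] rewrite drop-[] {A = ℚ} d = []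
Ballot⇒≤ₚ {d} ((H , _) ∷ xs) (t< ∷ sorted) (H∷ ballot) =
  ∷-≤ₚ-drop d (All-timesOf P xs t<) (Ballot⇒≤ₚ xs sorted ballot)
Ballot⇒≤ₚ     ((P , _) ∷ xs) (_  ∷ sorted) (P∷ ballot) = Ballot⇒≤ₚ xs sorted ballot

toℚ : ℕ → ℚ
toℚ zero    = 0ℚ
toℚ (suc k) = toℚ k ℚ.+ 1ℚ

toℚ-< : ∀ k → toℚ k ℚ.< toℚ (suc k)
toℚ-< k = subst (ℚ._< toℚ (suc k)) (ℚₚ.+-identityʳ (toℚ k)) (ℚₚ.+-monoʳ-< (toℚ k) (ℚₚ.positive⁻¹ 1ℚ))

stamp : ℕ → List Letter → List (Letter × ℚ)
stamp k []      = []
stamp k (c ∷ w) = (c , toℚ (suc k)) ∷ stamp (suc k) w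

map-proj₁-stamp : ∀ k w → map proj₁ (stamp k w) ≡ w
map-proj₁-stamp k []      = refl
map-proj₁-stamp k (c ∷ w) = cong (c ∷_) (map-proj₁-stamp (suc k) w)

stamp-> : ∀ k w → All (λ x → toℚ k ℚ.< proj₂ x) (stamp k w)
stamp-> k []      = []
stamp-> k (c ∷ w) = toℚ-< k ∷ All.map (ℚₚ.<-trans (toℚ-< k)) (stamp-> (suc k) w)

stamp-sorted : ∀ k w → AllPairs _<ₜ_ (stamp k w)
stamp-sorted k []      = []
stamp-sorted k (c ∷ w) = stamp-> (suc k) w ∷ stamp-sorted (suc k) w

-- Caterpillars and hosting

module _ {k : ℕ} where

  caterpillar : BTree k → List (BTree k) → List ℚ → BTree k
  caterpillar t (u ∷ us) (q ∷ qs) = caterpillar (node q t u) us qs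
  caterpillar t []       _        = t
  caterpillar t (_ ∷ _)  []       = t

  leaves-caterpillar : ∀ t us qs → length us ≤ length qs →
                       leaves (caterpillar t us qs) ≡ leaves t ++ concat (map leaves us)
  leaves-caterpillar t []       _        _          = sym (++-identityʳ (leaves t))
  leaves-caterpillar t (u ∷ us) (q ∷ qs) (s≤s us≤qs) =
    trans (leaves-caterpillar (node q t u) us qs us≤qs) (++-assoc (leaves t) (leaves u) _)

  internalTimes-caterpillar : ∀ t us qs → length us ≤ length qs →
    internalTimes (caterpillar t us qs) ↭ take (length us) qs ++ internalTimes t ++ concat (map internalTimes us)
  internalTimes-caterpillar t []       _        _           = ↭-reflexive (sym (++-identityʳ (internalTimes t)))
  internalTimes-caterpillar t (u ∷ us) (q ∷ qs) (s≤s us≤qs) = begin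
    internalTimes (caterpillar (node q t u) us qs)
      ↭⟨ internalTimes-caterpillar (node q t u) us qs us≤qs ⟩
    take (length us) qs ++ q ∷ (internalTimes t ++ internalTimes u) ++ concat (map internalTimes us)
      ↭⟨ shift q (take (length us) qs) _ ⟩
    q ∷ take (length us) qs ++ (internalTimes t ++ internalTimes u) ++ concat (map internalTimes us)
      ≡⟨ cong (λ zs → q ∷ take (length us) qs ++ zs) (++-assoc (internalTimes t) (internalTimes u) _) ⟩
    q ∷ take (length us) qs ++ internalTimes t ++ internalTimes u ++ concat (map internalTimes us) ∎
    where open PermutationReasoning

  MonotoneTimes-caterpillar : ∀ t us qs → MonotoneTimes t → All MonotoneTimes us →
    (∀ {u q} → u ∈ t ∷ us → q ∈ qs → rootTime u ℚ.≤ q) → AllPairs ℚ._≤_ qs →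
    MonotoneTimes (caterpillar t us qs)
  MonotoneTimes-caterpillar t []       _        monoₜ _ _ _ = monoₜ
  MonotoneTimes-caterpillar t (_ ∷ _)  []       monoₜ _ _ _ = monoₜ
  MonotoneTimes-caterpillar t (u ∷ us) (q ∷ qs) monoₜ (monoᵤ ∷ monos) roots≤ (q≤ ∷ sorted) =
    MonotoneTimes-caterpillar (node q t u) us qs
      (roots≤ (here refl) (here refl) , roots≤ (there (here refl)) (here refl) , monoₜ , monoᵤ) monos
      (λ { (here refl) q′∈ → All.lookup q≤ q′∈
         ; (there u′∈) q′∈ → roots≤ (there (there u′∈)) (there q′∈) })
      sorted

  ⊑-caterpillar : ∀ {s t} us qs → s ⊑ t → s ⊑ caterpillar t us qs
  ⊑-caterpillar []       _        s⊑t = s⊑t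
  ⊑-caterpillar (_ ∷ _)  []       s⊑t = s⊑t
  ⊑-caterpillar (_ ∷ us) (_ ∷ qs) s⊑t = ⊑-caterpillar us qs (⊑-left s⊑t)

  concat-leaves-leaf : ∀ (xs : List (Fin k)) → concat (map leaves (map leaf xs)) ≡ xs
  concat-leaves-leaf []       = refl
  concat-leaves-leaf (x ∷ xs) = cong (x ∷_) (concat-leaves-leaf xs)

  concat-internalTimes-leaf : ∀ (xs : List (Fin k)) → concat (map internalTimes (map leaf xs)) ≡ []
  concat-internalTimes-leaf []       = refl
  concat-internalTimes-leaf (_ ∷ xs) = concat-internalTimes-leaf xs

module _ {n m : ℕ} (ℓ : Fin m → Fin n) where

  Hosts : BTree n → BTree m → Set
  Hosts U T = ∀ {s} → s ⊑ T →
    ∃[ u ] u ⊑ U × (∀ {j} → j ∈ leaves s → ℓ j ∈ leaves u) × rootTime u ℚ.≤ rootTime s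

  hosts-⊑ : ∀ {U U′ T} → U ⊑ U′ → Hosts U T → Hosts U′ T
  hosts-⊑ U⊑U′ hosts s⊑T with u , u⊑U , rest ← hosts s⊑T = u , ⊑-trans u⊑U U⊑U′ , rest

  leaf-hosts : ∀ {x T} → MonotoneTimes T → (∀ {j} → j ∈ leaves T → ℓ j ≡ x) → Hosts (leaf x) T
  leaf-hosts monoT over {s} s⊑T =
    leaf _ , ⊑-refl , (λ j∈ → here (over (∈-leaves-⊑ s⊑T j∈))) , 0≤rootTime s (MonotoneTimes-⊑ s⊑T monoT)

  hosts-node : ∀ {h q U U′ T T′} → h ℚ.≤ q → Hosts U T → Hosts U′ T′ → Hosts (node h U U′) (node q T T′)
  hosts-node {U = U} {T = T} h≤q hosts hosts′ ⊑-refl = _ , ⊑-refl , ℓ-leaves , h≤q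
    where
    ℓ-leaves : ∀ {j} → j ∈ leaves T ++ _ → ℓ j ∈ leaves U ++ _
    ℓ-leaves j∈ with ∈-++⁻ (leaves T) j∈
    ... | inj₁ j∈T  with u , u⊑U , ℓ∈ , _ ← hosts ⊑-refl = ∈-++⁺ˡ (∈-leaves-⊑ u⊑U (ℓ∈ j∈T))
    ... | inj₂ j∈T′ with u , u⊑U′ , ℓ∈ , _ ← hosts′ ⊑-refl =
      ∈-++⁺ʳ (leaves U) (∈-leaves-⊑ u⊑U′ (ℓ∈ j∈T′))
  hosts-node _ hosts _ (⊑-left s⊑T)
    with u , u⊑U , rest ← hosts s⊑T = u , ⊑-left u⊑U , rest
  hosts-node _ _ hosts′ (⊑-right s⊑T′)
    with u , u⊑U′ , rest ← hosts′ s⊑T′ = u , ⊑-right u⊑U′ , rest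

  caterpillar-hosts : ∀ {U T} (TX : List (BTree m × Fin n)) J {hs qs} → Hosts U T →
    All (λ (T′ , x) → Hosts (leaf x) T′) TX → hs ≤ₚ qs → length TX ≡ length qs →
    Hosts (caterpillar U (map leaf (map proj₂ TX ++ J)) hs) (caterpillar T (map proj₁ TX) qs)
  caterpillar-hosts []              J {hs} hosts _ _ _ = hosts-⊑ (⊑-caterpillar (map leaf J) hs ⊑-refl) hosts
  caterpillar-hosts ((T′ , x) ∷ TX) J hosts (hosts′ ∷ hostsTX) (h≤q ∷ hs≤qs) length≡ =
    caterpillar-hosts TX J (hosts-node h≤q hosts hosts′) hostsTX hs≤qs (ℕ.suc-injective length≡)

  hosts⇒nests : ∀ {tH tP} → UltraBinTree n tH → UltraBinTree m tP → Hosts tH tP → Nests ℓ tH tP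
  hosts⇒nests {tH} {tP} ultraH ultraP hosts i j
    with s , s⊑tP , i∈s , j∈s , lcaP≡s ← lcaTime-attained tP (∈-leaves ultraP i) (∈-leaves ultraP j)
    with u , u⊑tH , ℓ-leaves , u≤s ← hosts s⊑tP = ℚₚ.+-mono-≤ lcaH≤lcaP lcaH≤lcaP
    where
    lcaH≤lcaP : lcaTime tH (ℓ i) (ℓ j) ℚ.≤ lcaTime tP i j
    lcaH≤lcaP = begin
      lcaTime tH (ℓ i) (ℓ j)
        ≤⟨ lcaTime≤rootTime-⊑ (Unique-leaves ultraH) (proj₂ ultraH) u⊑tH (ℓ-leaves i∈s) (ℓ-leaves j∈s) ⟩
      rootTime u              ≤⟨ u≤s ⟩
      rootTime s              ≡⟨ lcaP≡s ⟨
      lcaTime tP i j          ∎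
      where open ℚₚ.≤-Reasoning

module _ {k : ℕ} where

  comb : Fin k → List (Fin k) → List ℚ → BTree k
  comb x xs qs = caterpillar (leaf x) (map leaf xs) qs

  leaves-comb : ∀ x xs qs → length xs ≤ length qs → leaves (comb x xs qs) ≡ x ∷ xs
  leaves-comb x xs qs xs≤qs =
    trans (leaves-caterpillar (leaf x) (map leaf xs) qs (subst (_≤ length qs) (sym (length-map leaf xs)) xs≤qs))
          (cong (x ∷_) (concat-leaves-leaf xs))

  internalTimes-comb : ∀ x xs qs → length xs ≤ length qs → internalTimes (comb x xs qs) ↭ take (length xs) qs
  internalTimes-comb x xs qs xs≤qs = begin
    internalTimes (comb x xs qs)
      ↭⟨ internalTimes-caterpillar (leaf x) (map leaf xs) qs (subst (_≤ length qs) (sym (length-map leaf xs)) xs≤qs) ⟩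
    take (length (map leaf xs)) qs ++ concat (map internalTimes (map leaf xs))
      ≡⟨ cong₂ (λ a zs → take a qs ++ zs) (length-map leaf xs) (concat-internalTimes-leaf xs) ⟩
    take (length xs) qs ++ []
      ≡⟨ ++-identityʳ _ ⟩
    take (length xs) qs ∎
    where open PermutationReasoning

  MonotoneTimes-comb : ∀ x xs qs → All (0ℚ ℚ.≤_) qs → AllPairs ℚ._≤_ qs → MonotoneTimes (comb x xs qs)
  MonotoneTimes-comb x xs qs 0≤qs sorted =
    MonotoneTimes-caterpillar (leaf x) (map leaf xs) qs _ (All.map⁺ (All.universal (λ _ → _) xs)) roots≤ sorted
    where
    roots≤ : ∀ {u q} → u ∈ leaf x ∷ map leaf xs → q ∈ qs → rootTime u ℚ.≤ q
    roots≤ (here refl) q∈ = All.lookup 0≤qs q∈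
    roots≤ (there u∈)  q∈ with _ , _ , refl ← ∈-map⁻ leaf u∈ = All.lookup 0≤qs q∈

  rootTime≡0⊎∈internalTimes : ∀ (t : BTree k) → rootTime t ≡ 0ℚ ⊎ rootTime t ∈ internalTimes t
  rootTime≡0⊎∈internalTimes (leaf _)     = inj₁ refl
  rootTime≡0⊎∈internalTimes (node _ _ _) = inj₂ (here refl)

-- Fibers of ℓ

module _ {n m : ℕ} (ℓ : Fin m → Fin n) where

  fiber : Fin n → List (Fin m)
  fiber x = filter (λ j → ℓ j ≟ᶠ x) (allFin m)

  ∈-fiber⁻ : ∀ {x j} → j ∈ fiber x → ℓ j ≡ x
  ∈-fiber⁻ {x} j∈ = proj₂ (∈-filter⁻ (λ j → ℓ j ≟ᶠ x) {xs = allFin m} j∈)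

  ∈-fiber⁺ : ∀ {x j} → ℓ j ≡ x → j ∈ fiber x
  ∈-fiber⁺ {x} {j} ℓj≡x = ∈-filter⁺ (λ j → ℓ j ≟ᶠ x) (∈-allFin j) ℓj≡x

  concat-fiber-↭ : ∀ {I} → Unique I → (∀ j → ℓ j ∈ I) → concat (map fiber I) ↭ allFin m
  concat-fiber-↭ {I} I! ℓ∈I = ∼bag⇒↭ (unique∧set⇒bag fibers! (allFin⁺ m) (mk⇔ (λ _ → ∈-allFin _) ∈fibers))
    where
    fibers! : Unique (concat (map fiber I))
    fibers! = Uniqueₚ.concat⁺ (All.map⁺ (All.universal (λ x → Uniqueₚ.filter⁺ (λ j → ℓ j ≟ᶠ x) (allFin⁺ m)) I))
                              (AllPairs.map⁺ (AllPairs.map disjoint I!))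
      where
      disjoint : ∀ {x y} → x ≢ y → Disjoint (fiber x) (fiber y)
      disjoint x≢y (j∈x , j∈y) = x≢y (trans (sym (∈-fiber⁻ j∈x)) (∈-fiber⁻ j∈y))
    ∈fibers : ∀ {j} → j ∈ allFin m → j ∈ concat (map fiber I)
    ∈fibers {j} _ = ∈-concat⁺′ (∈-fiber⁺ refl) (∈-map⁺ fiber (ℓ∈I j))

  consumed : List (Fin n) → ℕ
  consumed I = sum (map (λ x → length (fiber x) ∸ 1) I)

  fiberTrees : List (Fin n) → List ℚ → List (BTree m × Fin n)
  fiberTrees []       qs = []
  fiberTrees (x ∷ xs) qs with fiber x
  ... | []     = fiberTrees xs qs
  ... | j ∷ js = (comb j js qs , x) ∷ fiberTrees xs (drop (length js) qs)

  map-proj₂-fiberTrees : ∀ I qs → All (λ x → ∃[ j ] ℓ j ≡ x) I → map proj₂ (fiberTrees I qs) ≡ I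
  map-proj₂-fiberTrees []       _  []                 = refl
  map-proj₂-fiberTrees (x ∷ xs) qs ((_ , ℓj≡x) ∷ imgs) with fiber x | ∈-fiber⁺ ℓj≡x
  ... | []     | ()
  ... | _ ∷ js | _ = cong (x ∷_) (map-proj₂-fiberTrees xs (drop (length js) qs) imgs)

  concat-leaves-fiberTrees : ∀ I qs → consumed I ≤ length qs →
    concat (map leaves (map proj₁ (fiberTrees I qs))) ≡ concat (map fiber I)
  concat-leaves-fiberTrees []       _  _  = refl
  concat-leaves-fiberTrees (x ∷ xs) qs c≤ with fiber x
  ... | []     = concat-leaves-fiberTrees xs qs c≤
  ... | j ∷ js = cong₂ _++_ (leaves-comb j js qs (ℕ.m+n≤o⇒m≤o (length js) c≤))
                            (concat-leaves-fiberTrees xs (drop (length js) qs) (≤-length-drop (length js) _ qs c≤))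

  internalTimes-fiberTrees : ∀ I qs → consumed I ≤ length qs →
    concat (map internalTimes (map proj₁ (fiberTrees I qs))) ↭ take (consumed I) qs
  internalTimes-fiberTrees []       _  _  = ↭-refl
  internalTimes-fiberTrees (x ∷ xs) qs c≤ with fiber x
  ... | []     = internalTimes-fiberTrees xs qs c≤
  ... | j ∷ js = begin
    internalTimes (comb j js qs) ++ concat (map internalTimes (map proj₁ (fiberTrees xs (drop (length js) qs))))
      ↭⟨ ++⁺ (internalTimes-comb j js qs (ℕ.m+n≤o⇒m≤o (length js) c≤))
             (internalTimes-fiberTrees xs (drop (length js) qs) (≤-length-drop (length js) _ qs c≤)) ⟩
    take (length js) qs ++ take (consumed xs) (drop (length js) qs)
      ≡⟨ take-+ (length js) (consumed xs) qs ⟨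
    take (length js + consumed xs) qs ∎
    where open PermutationReasoning

  LiesOver : BTree m × Fin n → Set
  LiesOver (T , x) = MonotoneTimes T × (∀ {j} → j ∈ leaves T → ℓ j ≡ x)

  fiberTrees-liesOver : ∀ I qs → consumed I ≤ length qs → All (0ℚ ℚ.≤_) qs → AllPairs ℚ._≤_ qs →
                        All LiesOver (fiberTrees I qs)
  fiberTrees-liesOver []       _  _  _    _      = []
  fiberTrees-liesOver (x ∷ xs) qs c≤ 0≤qs sorted with fiber x in fiber≡
  ... | []     = fiberTrees-liesOver xs qs c≤ 0≤qs sorted
  ... | j ∷ js = (MonotoneTimes-comb j js qs 0≤qs sorted , over)
               ∷ fiberTrees-liesOver xs (drop (length js) qs) (≤-length-drop (length js) _ qs c≤)
                   (All.drop⁺ (length js) 0≤qs) (AllPairs.drop⁺ (length js) sorted)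
    where
    over : ∀ {j′} → j′ ∈ leaves (comb j js qs) → ℓ j′ ≡ x
    over j′∈ =
      ∈-fiber⁻ (subst (_ ∈_) (trans (leaves-comb j js qs (ℕ.m+n≤o⇒m≤o (length js) c≤)) (sym fiber≡)) j′∈)

  suc-length∸1 : ∀ {x} {xs : List (Fin m)} → x ∈ xs → suc (length xs ∸ 1) ≡ length xs
  suc-length∸1 {xs = _ ∷ _} _ = refl

  consumed+length : ∀ I → All (λ x → ∃[ j ] ℓ j ≡ x) I → consumed I + length I ≡ length (concat (map fiber I))
  consumed+length []       []                 = refl
  consumed+length (x ∷ xs) ((_ , ℓj≡x) ∷ imgs) = begin
    (length (fiber x) ∸ 1 + consumed xs) + suc (length xs)  ≡⟨ ℕ.+-suc _ (length xs) ⟩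
    suc ((length (fiber x) ∸ 1 + consumed xs) + length xs)  ≡⟨ cong suc (ℕ.+-assoc (length (fiber x) ∸ 1) _ _) ⟩
    suc (length (fiber x) ∸ 1) + (consumed xs + length xs)
      ≡⟨ cong₂ _+_ (suc-length∸1 (∈-fiber⁺ ℓj≡x)) (consumed+length xs imgs) ⟩
    length (fiber x) + length (concat (map fiber xs))       ≡⟨ length-++ (fiber x) ⟨
    length (fiber x ++ concat (map fiber xs))               ∎
    where open ≡-Reasoning

module Realisation {n m : ℕ} (ℓ : Fin m → Fin n) (1≤m : 1 ≤ m) (w : List Letter)
                   (#H : count H w ≡ n ∸ 1) (#P : count P w ≡ m ∸ 1) (ballot : Ballot (m ∸ imageSize ℓ) w) where

  xs : List (Letter × ℚ)
  xs = stamp 0 w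

  sorted : AllPairs _<ₜ_ xs
  sorted = stamp-sorted 0 w

  hs ps : List ℚ
  hs = timesOf H xs
  ps = timesOf P xs

  hs-sorted : AllPairs ℚ._≤_ hs
  hs-sorted = AllPairs.map ℚₚ.<⇒≤ (AllPairs-timesOf H sorted)

  ps-sorted : AllPairs ℚ._<_ ps
  ps-sorted = AllPairs-timesOf P sorted

  0≤hs : All (0ℚ ℚ.≤_) hs
  0≤hs = All.map ℚₚ.<⇒≤ (All-timesOf H xs (stamp-> 0 w))

  0≤ps : All (0ℚ ℚ.≤_) ps
  0≤ps = All.map ℚₚ.<⇒≤ (All-timesOf P xs (stamp-> 0 w))

  length-timesOf-stamp : ∀ c → length (timesOf c xs) ≡ count c w
  length-timesOf-stamp c = trans (length-timesOf c xs) (cong (count c) (map-proj₁-stamp 0 w))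

  I J : List (Fin n)
  I = filter (image? ℓ) (allFin n)
  J = filter (∁? (image? ℓ)) (allFin n)

  I++J↭ : I ++ J ↭ allFin n
  I++J↭ = filter-++-∁-↭ (image? ℓ) (allFin n)

  I! : Unique I
  I! = Unique-++⁻ˡ I (Unique-resp-↭ (↭-sym I++J↭) (allFin⁺ n))

  ℓ∈I : ∀ j → ℓ j ∈ I
  ℓ∈I j = ∈-filter⁺ (image? ℓ) (∈-allFin (ℓ j)) (j , refl)

  images : All (λ x → ∃[ j ] ℓ j ≡ x) I
  images = All.all-filter (image? ℓ) (allFin n)

  consumed+length-I≡m : consumed ℓ I + length I ≡ m
  consumed+length-I≡m = begin
    consumed ℓ I + length I            ≡⟨ consumed+length ℓ I images ⟩
    length (concat (map (fiber ℓ) I))  ≡⟨ ↭-length (concat-fiber-↭ ℓ I! ℓ∈I) ⟩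
    length (allFin m)                  ≡⟨ length-tabulate (λ j → j) ⟩
    m                                  ∎
    where open ≡-Reasoning

  d : ℕ
  d = m ∸ imageSize ℓ

  consumed≡d : consumed ℓ I ≡ d
  consumed≡d = trans (sym (ℕ.m+n∸n≡m _ (length I))) (cong (_∸ length I) consumed+length-I≡m)

  consumed≤length-ps : consumed ℓ I ≤ length ps
  consumed≤length-ps = begin
    consumed ℓ I  ≡⟨ consumed≡d ⟩
    m ∸ length I  ≤⟨ ℕ.∸-monoʳ-≤ m (∈-length (ℓ∈I (fromℕ< 1≤m))) ⟩
    m ∸ 1         ≡⟨ trans (length-timesOf-stamp P) #P ⟨
    length ps     ∎
    where open ℕ.≤-Reasoning

  forest : List (BTree m × Fin n)
  forest = fiberTrees ℓ I ps

  module Trees (T₁ : BTree m) (x₁ : Fin n) (TX : List (BTree m × Fin n)) (forest≡ : forest ≡ (T₁ , x₁) ∷ TX) where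

    L : List (Fin n)
    L = map proj₂ TX ++ J

    Ts : List (BTree m)
    Ts = map proj₁ TX

    tH : BTree n
    tH = comb x₁ L hs

    tP : BTree m
    tP = caterpillar T₁ Ts (drop d ps)

    x₁∷TX≡I : x₁ ∷ map proj₂ TX ≡ I
    x₁∷TX≡I = trans (cong (map proj₂) (sym forest≡)) (map-proj₂-fiberTrees ℓ I ps images)

    length-L≡hs : length L ≡ length hs
    length-L≡hs = begin
      length L                        ≡⟨⟩
      length ((x₁ ∷ map proj₂ TX) ++ J) ∸ 1 ≡⟨ cong (λ I′ → length (I′ ++ J) ∸ 1) x₁∷TX≡I ⟩
      length (I ++ J) ∸ 1             ≡⟨ cong (_∸ 1) (trans (↭-length I++J↭) (length-tabulate {n = n} (λ x → x))) ⟩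
      n ∸ 1                           ≡⟨ trans (length-timesOf-stamp H) #H ⟨
      length hs                       ∎
      where open ≡-Reasoning

    length-Ts≡ : length Ts ≡ length (drop d ps)
    length-Ts≡ = begin
      length Ts                          ≡⟨ length-map proj₁ TX ⟩
      length TX                          ≡⟨ ℕ.m+n∸m≡n d (length TX) ⟨
      d + length TX ∸ d                  ≡⟨ cong (λ k → k ∸ 1 ∸ d) d+length-I≡m ⟩
      m ∸ 1 ∸ d                          ≡⟨ cong (_∸ d) (trans (length-timesOf-stamp P) #P) ⟨
      length ps ∸ d                      ≡⟨ length-drop d ps ⟨
      length (drop d ps)                 ∎
      where
      open ≡-Reasoning
      d+length-I≡m : suc (d + length TX) ≡ m
      d+length-I≡m = begin
        suc (d + length TX)              ≡⟨ ℕ.+-suc d (length TX) ⟨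
        d + suc (length TX)              ≡⟨ cong (λ k → d + suc k) (length-map proj₂ TX) ⟨
        d + length (x₁ ∷ map proj₂ TX)   ≡⟨ cong (λ I′ → d + length I′) x₁∷TX≡I ⟩
        d + length I                     ≡⟨ cong (_+ length I) consumed≡d ⟨
        consumed ℓ I + length I          ≡⟨ consumed+length-I≡m ⟩
        m                                ∎

    ultraH : UltraBinTree n tH
    ultraH = subst (_↭ allFin n) leaves≡ I++J↭ , MonotoneTimes-comb x₁ L hs 0≤hs hs-sorted
      where
      leaves≡ : I ++ J ≡ leaves tH
      leaves≡ = trans (cong (_++ J) (sym x₁∷TX≡I)) (sym (leaves-comb x₁ L hs (ℕ.≤-reflexive length-L≡hs)))

    internalTimes-forest : concat (map internalTimes (T₁ ∷ Ts)) ↭ take d ps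
    internalTimes-forest =
      subst₂ _↭_ (cong (concat ∘ map internalTimes ∘ map proj₁) forest≡) (cong (λ c → take c ps) consumed≡d)
                 (internalTimes-fiberTrees ℓ I ps consumed≤length-ps)

    liesOver : All (LiesOver ℓ) ((T₁ , x₁) ∷ TX)
    liesOver = subst (All (LiesOver ℓ)) forest≡
                     (fiberTrees-liesOver ℓ I ps consumed≤length-ps 0≤ps (AllPairs.map ℚₚ.<⇒≤ ps-sorted))

    roots≤ : ∀ {u q} → u ∈ T₁ ∷ Ts → q ∈ drop d ps → rootTime u ℚ.≤ q
    roots≤ {u} {q} u∈ q∈ with rootTime≡0⊎∈internalTimes u
    ... | inj₁ root≡0 = subst (ℚ._≤ q) (sym root≡0) (All.lookup (All.drop⁺ d 0≤ps) q∈)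
    ... | inj₂ root∈  = ℚₚ.<⇒≤ (AllPairs-take-drop d ps-sorted
                          (∈-resp-↭ internalTimes-forest (∈-concat⁺′ root∈ (∈-map⁺ internalTimes u∈))) q∈)

    ultraP : UltraBinTree m tP
    ultraP = subst (_↭ allFin m) leaves≡ (concat-fiber-↭ ℓ I! ℓ∈I) , mono
      where
      leaves≡ : concat (map (fiber ℓ) I) ≡ leaves tP
      leaves≡ = begin
        concat (map (fiber ℓ) I)                          ≡⟨ concat-leaves-fiberTrees ℓ I ps consumed≤length-ps ⟨
        concat (map leaves (map proj₁ forest))            ≡⟨ cong (concat ∘ map leaves ∘ map proj₁) forest≡ ⟩
        leaves T₁ ++ concat (map leaves Ts)
          ≡⟨ leaves-caterpillar T₁ Ts (drop d ps) (ℕ.≤-reflexive length-Ts≡) ⟨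
        leaves tP                                         ∎
        where open ≡-Reasoning
      mono : MonotoneTimes tP
      mono = MonotoneTimes-caterpillar T₁ Ts (drop d ps) (proj₁ (All.head liesOver))
               (All.map⁺ (All.map proj₁ (All.tail liesOver))) roots≤ (AllPairs.drop⁺ d (AllPairs.map ℚₚ.<⇒≤ ps-sorted))

    nests : Nests ℓ tH tP
    nests = hosts⇒nests ℓ ultraH ultraP
              (caterpillar-hosts ℓ TX J (uncurry (leaf-hosts ℓ) (All.head liesOver))
                 (All.map (uncurry (leaf-hosts ℓ)) (All.tail liesOver))
                 (Ballot⇒≤ₚ xs sorted (subst (Ballot d) (sym (map-proj₁-stamp 0 w)) ballot))
                 (trans (sym (length-map proj₁ TX)) length-Ts≡))

    internalTimes-tH : internalTimes tH ↭ hs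
    internalTimes-tH = begin
      internalTimes tH       ↭⟨ internalTimes-comb x₁ L hs (ℕ.≤-reflexive length-L≡hs) ⟩
      take (length L) hs     ≡⟨ take-all (length L) hs (ℕ.≤-reflexive (sym length-L≡hs)) ⟩
      hs                     ∎
      where open PermutationReasoning

    internalTimes-tP : internalTimes tP ↭ ps
    internalTimes-tP = begin
      internalTimes tP
        ↭⟨ internalTimes-caterpillar T₁ Ts (drop d ps) (ℕ.≤-reflexive length-Ts≡) ⟩
      take (length Ts) (drop d ps) ++ concat (map internalTimes (T₁ ∷ Ts))
        ≡⟨ cong (_++ concat (map internalTimes (T₁ ∷ Ts)))
                (take-all (length Ts) (drop d ps) (ℕ.≤-reflexive (sym length-Ts≡))) ⟩
      drop d ps ++ concat (map internalTimes (T₁ ∷ Ts))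
        ↭⟨ ++⁺ˡ (drop d ps) internalTimes-forest ⟩
      drop d ps ++ take d ps
        ↭⟨ ++-comm (drop d ps) (take d ps) ⟩
      take d ps ++ drop d ps
        ≡⟨ take++drop≡id d ps ⟩
      ps ∎
      where open PermutationReasoning

    admissible : Admissible n m ℓ w
    admissible = tH , tP , ultraH , ultraP , nests ,
                 Unique-resp-↭ (↭-sym (++⁺ internalTimes-tH internalTimes-tP)) (Unique-timesOf-++ sorted) ,
                 xs , map-proj₁-stamp 0 w , Linkedₚ.AllPairs⇒Linked sorted ,
                 ↭-sym internalTimes-tH , ↭-sym internalTimes-tP

  admissible : Admissible n m ℓ w
  admissible with forest in forest≡
  ... | [] with () ← subst (ℓ (fromℕ< 1≤m) ∈_)
                           (trans (sym (map-proj₂-fiberTrees ℓ I ps images)) (cong (map proj₂) forest≡))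
                           (ℓ∈I (fromℕ< 1≤m))
  ... | (T₁ , x₁) ∷ TX = Trees.admissible T₁ x₁ TX forest≡

mainTheorem4 : (n m : ℕ) → 1 ≤ n → 1 ≤ m → (ℓ : Fin m → Fin n)
    → (S : Vec Letter (n + m ∸ 2))
    → count H (toList S) ≡ n ∸ 1 → count P (toList S) ≡ m ∸ 1
    → Admissible n m ℓ (toList S)
      ⇔ (∀ (i : Fin (n + m ∸ 2)) →
           count P (take (suc (toℕ i)) (toList S))
             ≤ count H (take (suc (toℕ i)) (toList S)) + (m ∸ imageSize ℓ))
-- 1 ≤ n is implied by 1 ≤ m, as ℓ : Fin m → Fin n.
mainTheorem4 n m _ 1≤m ℓ S #H #P = mk⇔
  (admissible⇒prefixBound ℓ S)
  (Realisation.admissible ℓ 1≤m (toList S) #H #P ∘ prefixBound⇒Ballot (m ∸ imageSize ℓ) S)
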